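{- Let $G=(V,E)$ be a finite simple undirected graph, $k$ a positive integer, $S\subseteq V$ a $k$-plex of $G$, and $C\subseteq V\setminus S$. Let $I\subseteq C$ and let $UB$ be an upper bound on the number of vertices that $I$ can provide for $S$. Let $v\in C$ and put $I'=I\cup\{v\}$. Suppose that the number of vertices $u\in I'$ that are conflict vertices of $I'$ or loose vertices of $I'$ (with respect to $UB$) is at most $UB$. Then $UB$ is an upper bound on the number of vertices that $I'$ can provide for $S$.
   Context: For $v\in V$, $N(v)$ denotes the set of vertices adjacent to $v$ (so $v\notin N(v)$). A set $S\subseteq V$ is a $k$-plex if every $v\in S$ satisfies $|S\setminus N(v)|\le k$. For $v\in V$, $\delta(S,v)=|S\setminus N(v)|$ and $\delta_k^{ - }(S,v)=k-\delta(S,v)$. The "number of vertices that a set $J\subseteq C$ can provide for $S$" means $\max\{|T| : T\subseteq J,\ S\cup T \text{ is a } k\text{ -plex}\}$; an upper bound on it is any number $\ge$ this maximum. Given a vertex set $J$, a conflict vertex of $J$ is a vertex $u\in J$ adjacent to at least one vertex of $J$. Given $J\subseteq C$ and a number $UB$, a loose vertex of $J$ (with respect to $UB$) is a vertex $u\in J$ with $\delta_k^{ - }(S,u)>UB$. -}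

module Defs where

open import Data.Nat using (ℕ; _≤_)
open import Data.Integer as ℤ using (ℤ; +_)
open import Data.Bool using (Bool; true; false)
open import Data.Fin using (Fin)
open import Data.Fin.Subset using (Subset; _∈_; _∉_; _⊆_; _∪_; _─_; ∣_∣; ⁅_⁆)
open import Data.Fin.Subset.Properties using (_∈?_)
open import Data.Fin.Properties using (any?)
open import Data.Vec using (tabulate)
open import Data.Product using (_×_; ∃; _,_)
open import Data.Sum using (_⊎_)
open import Relation.Nullary using (Dec; does; ¬_)
open import Relation.Nullary.Decidable using (_×-dec_; _⊎-dec_)
open import Relation.Binary.PropositionalEquality using (_≡_)
open import Data.Bool.Properties using () renaming (_≟_ to _≟ᵇ_)

record Graph (n : ℕ) : Set where
  field
    adj    : Fin n → Fin n → Bool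
    sym    : ∀ u w → adj u w ≡ adj w u
    irrefl : ∀ u → adj u u ≡ false

module _ {n : ℕ} (G : Graph n) where
  open Graph G

  Adj : Fin n → Fin n → Set
  Adj u w = adj u w ≡ true

  -- N(v): the open neighbourhood of v (v ∉ N(v) since G has no loops)
  N : Fin n → Subset n
  N v = tabulate (adj v)

  δ : Subset n → Fin n → ℕ
  δ S v = ∣ S ─ N v ∣

  δ⁻ : ℕ → Subset n → Fin n → ℤ
  δ⁻ k S v = + k ℤ.- + δ S v

  IsKPlex : ℕ → Subset n → Set
  IsKPlex k S = ∀ v → v ∈ S → δ S v ≤ k

  UpperBoundProvide : ℕ → Subset n → Subset n → ℕ → Set
  UpperBoundProvide k S J UB = ∀ T → T ⊆ J → IsKPlex k (S ∪ T) → ∣ T ∣ ≤ UB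

  IsConflict : Subset n → Fin n → Set
  IsConflict J u = u ∈ J × ∃ λ w → w ∈ J × Adj u w

  IsLoose : ℕ → Subset n → Subset n → ℕ → Fin n → Set
  IsLoose k S J UB u = u ∈ J × (+ UB ℤ.< δ⁻ k S u)

  isConflict? : ∀ J u → Dec (IsConflict J u)
  isConflict? J u = (u ∈? J) ×-dec any? (λ w → (w ∈? J) ×-dec (adj u w ≟ᵇ true))

  isLoose? : ∀ k S J UB u → Dec (IsLoose k S J UB u)
  isLoose? k S J UB u = (u ∈? J) ×-dec (+ UB ℤ.<? δ⁻ k S u)

  ConflictOrLoose : ℕ → Subset n → Subset n → ℕ → Subset n
  ConflictOrLoose k S J UB =
    tabulate (λ u → does (isConflict? J u ⊎-dec isLoose? k S J UB u))

-- Take T ⊆ I ∪ {v} with S ∪ T a k-plex. If every vertex of T is a conflict or a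
-- loose vertex, then |T| ≤ UB by hypothesis. Otherwise some u ∈ T is neither. As u
-- has no neighbour in T, the disjoint sets S \ N(u) and T both lie in (S ∪ T) \ N(u),
-- so δ(S,u) + |T| ≤ k; as u is not loose, k - δ(S,u) ≤ UB.
module Submission where

open import Defs
open import Data.Nat using (ℕ; _≤_; NonZero)
open import Data.Fin using (Fin)
open import Data.Fin.Subset using (Subset; _∈_; _∉_; _⊆_; _∪_; ∣_∣; ⁅_⁆)

open import Data.Bool using (Bool; true)
open import Data.Fin.Properties using (any?)
open import Data.Fin.Subset using (inside; outside; _─_)
open import Data.Fin.Subset.Properties
  using (_∈?_; p⊆q⇒∣p∣≤∣q∣; x∈p∪q⁻; x∈⁅y⁆⇒x≡y; p⊆p∪q; q⊆p∪q; x∈p∧x∉q⇒x∈p─q; p─q⊆p)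
open import Data.Integer as ℤ using (+_)
import Data.Integer.Properties as ℤ
open import Data.Nat using (suc; _+_; _∸_)
import Data.Nat.Properties as ℕ
open import Data.Product using (_×_; _,_; ∃)
open import Data.Sum using (_⊎_; inj₁; inj₂)
open import Data.Vec using ([]; _∷_; tabulate)
open import Data.Vec.Base using (here; there)
open import Data.Vec.Properties using ([]=⇒lookup; lookup⇒[]=; lookup∘tabulate)
open import Relation.Nullary using (¬_; yes; no; contradiction)
open import Relation.Nullary.Decidable using (¬?; _×-dec_; _⊎-dec_; dec-true; decidable-stable)
open import Relation.Binary.PropositionalEquality using (_≡_; refl; sym; trans; subst; cong)
open import Function using (_∘_)

x∈tabulate⁺ : ∀ {n} (f : Fin n → Bool) {x} → f x ≡ true → x ∈ tabulate f
x∈tabulate⁺ f {x} fx = lookup⇒[]= x (tabulate f) (trans (lookup∘tabulate f x) fx)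

x∈tabulate⁻ : ∀ {n} (f : Fin n → Bool) {x} → x ∈ tabulate f → f x ≡ true
x∈tabulate⁻ f {x} x∈ = trans (sym (lookup∘tabulate f x)) ([]=⇒lookup x∈)

x∈p⇒⁅x⁆⊆p : ∀ {n} {x : Fin n} {p} → x ∈ p → ⁅ x ⁆ ⊆ p
x∈p⇒⁅x⁆⊆p {x = x} x∈p y∈⁅x⁆ = subst (_∈ _) (sym (x∈⁅y⁆⇒x≡y x y∈⁅x⁆)) x∈p

∪-⊆ : ∀ {n} {p q r : Subset n} → p ⊆ r → q ⊆ r → p ∪ q ⊆ r
∪-⊆ {p = p} {q} p⊆r q⊆r x∈p∪q with x∈p∪q⁻ p q x∈p∪q
... | inj₁ x∈p = p⊆r x∈p
... | inj₂ x∈q = q⊆r x∈q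

⊆⊎∃∉ : ∀ {n} (p q : Subset n) → p ⊆ q ⊎ ∃ λ x → x ∈ p × x ∉ q
⊆⊎∃∉ p q with any? (λ x → (x ∈? p) ×-dec ¬? (x ∈? q))
... | yes x∈p─q = inj₂ x∈p─q
... | no ∄x = inj₁ λ {x} x∈p → decidable-stable (x ∈? q) (λ x∉q → ∄x (x , x∈p , x∉q))

x∈p─q⇒x∉q : ∀ {n} {x : Fin n} (p q : Subset n) → x ∈ p ─ q → x ∉ q
x∈p─q⇒x∉q (inside ∷ p) (outside ∷ q) here      ()
x∈p─q⇒x∉q (_ ∷ p)      (_ ∷ q)       (there m) (there x∈q) = x∈p─q⇒x∉q p q m x∈q

p⊆q⇒p─r⊆q─r : ∀ {n} {p q : Subset n} (r : Subset n) → p ⊆ q → p ─ r ⊆ q ─ r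
p⊆q⇒p─r⊆q─r {p = p} r p⊆q x∈p─r =
  x∈p∧x∉q⇒x∈p─q (p⊆q (p─q⊆p p r x∈p─r)) (x∈p─q⇒x∉q p r x∈p─r)

drop-∷-disjoint : ∀ {n s t} {p q : Subset n} →
                  (∀ {x} → x ∈ s ∷ p → x ∉ t ∷ q) → ∀ {x} → x ∈ p → x ∉ q
drop-∷-disjoint disj x∈p x∈q = disj (there x∈p) (there x∈q)

∣p∪q∣≡∣p∣+∣q∣ : ∀ {n} (p q : Subset n) → (∀ {x} → x ∈ p → x ∉ q) →
                ∣ p ∪ q ∣ ≡ ∣ p ∣ + ∣ q ∣
∣p∪q∣≡∣p∣+∣q∣ []            []            _    = refl
∣p∪q∣≡∣p∣+∣q∣ (inside ∷ p)  (inside ∷ q)  disj = contradiction here (disj here)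
∣p∪q∣≡∣p∣+∣q∣ (inside ∷ p)  (outside ∷ q) disj = cong suc (∣p∪q∣≡∣p∣+∣q∣ p q (drop-∷-disjoint disj))
∣p∪q∣≡∣p∣+∣q∣ (outside ∷ p) (inside ∷ q)  disj =
  trans (cong suc (∣p∪q∣≡∣p∣+∣q∣ p q (drop-∷-disjoint disj))) (sym (ℕ.+-suc ∣ p ∣ ∣ q ∣))
∣p∪q∣≡∣p∣+∣q∣ (outside ∷ p) (outside ∷ q) disj = ∣p∪q∣≡∣p∣+∣q∣ p q (drop-∷-disjoint disj)

module _ {n : ℕ} (G : Graph n) where
  open Graph G using (adj)

  δ+∣T∣≤δ[S∪T] : ∀ {S T : Subset n} {u} → (∀ {x} → x ∈ S → x ∉ T) →
                 (∀ {w} → w ∈ T → ¬ Adj G u w) → δ G S u + ∣ T ∣ ≤ δ G (S ∪ T) u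
  δ+∣T∣≤δ[S∪T] {S} {T} {u} S∩T≡∅ u≁T = subst (_≤ δ G (S ∪ T) u)
    (∣p∪q∣≡∣p∣+∣q∣ (S ─ N G u) T (λ x∈S─Nu → S∩T≡∅ (p─q⊆p S (N G u) x∈S─Nu)))
    (p⊆q⇒∣p∣≤∣q∣ (∪-⊆ (p⊆q⇒p─r⊆q─r (N G u) (p⊆p∪q T)) T⊆[S∪T]─Nu))
    where
    T⊆[S∪T]─Nu : T ⊆ (S ∪ T) ─ N G u
    T⊆[S∪T]─Nu x∈T = x∈p∧x∉q⇒x∈p─q (q⊆p∪q S T x∈T) (u≁T x∈T ∘ x∈tabulate⁻ (adj u))

  δ⁻≡+[k∸δ] : ∀ {k S u} → δ G S u ≤ k → δ⁻ G k S u ≡ + (k ∸ δ G S u)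
  δ⁻≡+[k∸δ] {k} {S} {u} δ≤k = trans (ℤ.[+m]-[+n]≡m⊖n k (δ G S u)) (ℤ.⊖-≥ δ≤k)

  ∉ConflictOrLoose : ∀ {k S J UB u} → u ∉ ConflictOrLoose G k S J UB →
                     ¬ (IsConflict G J u ⊎ IsLoose G k S J UB u)
  ∉ConflictOrLoose {k} {S} {J} {UB} {u} u∉ =
    u∉ ∘ x∈tabulate⁺ _ ∘ dec-true (isConflict? G J u ⊎-dec isLoose? G k S J UB u)

  u∉ConflictOrLoose⇒∣T∣≤UB : ∀ {k S J UB T u} → T ⊆ J → (∀ {x} → x ∈ S → x ∉ T) →
                             IsKPlex G k (S ∪ T) → u ∈ T →
                             u ∉ ConflictOrLoose G k S J UB → ∣ T ∣ ≤ UB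
  u∉ConflictOrLoose⇒∣T∣≤UB {k} {S} {J} {UB} {T} {u} T⊆J S∩T≡∅ plex u∈T u∉ =
    ℕ.≤-trans ∣T∣≤k∸δ k∸δ≤UB
    where
    neither : ¬ (IsConflict G J u ⊎ IsLoose G k S J UB u)
    neither = ∉ConflictOrLoose {k} {S} {J} {UB} u∉

    u≁T : ∀ {w} → w ∈ T → ¬ Adj G u w
    u≁T w∈T u~w = neither (inj₁ (T⊆J u∈T , _ , T⊆J w∈T , u~w))

    δ+∣T∣≤k : δ G S u + ∣ T ∣ ≤ k
    δ+∣T∣≤k = ℕ.≤-trans (δ+∣T∣≤δ[S∪T] S∩T≡∅ u≁T) (plex u (q⊆p∪q S T u∈T))

    ∣T∣≤k∸δ : ∣ T ∣ ≤ k ∸ δ G S u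
    ∣T∣≤k∸δ = ℕ.m+n≤o⇒m≤o∸n ∣ T ∣ (subst (_≤ k) (ℕ.+-comm (δ G S u) ∣ T ∣) δ+∣T∣≤k)

    k∸δ≤UB : k ∸ δ G S u ≤ UB
    k∸δ≤UB = ℤ.drop‿+≤+ (subst (ℤ._≤ + UB) (δ⁻≡+[k∸δ] {k} {S} (ℕ.m+n≤o⇒m≤o _ δ+∣T∣≤k))
                                (ℤ.≮⇒≥ (neither ∘ inj₂ ∘ (T⊆J u∈T ,_))))

lemma2 : {n : ℕ} (G : Graph n) (k : ℕ) → NonZero k →
    (S C I : Subset n) (UB : ℕ) (v : Fin n) →
    IsKPlex G k S →
    (∀ u → u ∈ C → u ∉ S) →
    I ⊆ C →
    UpperBoundProvide G k S I UB →
    v ∈ C →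
    ∣ ConflictOrLoose G k S (I ∪ ⁅ v ⁆) UB ∣ ≤ UB →
    UpperBoundProvide G k S (I ∪ ⁅ v ⁆) UB
lemma2 G k _ S C I UB v _ C∩S≡∅ I⊆C _ v∈C ∣CL∣≤UB T T⊆I′ plex
  with ⊆⊎∃∉ T (ConflictOrLoose G k S (I ∪ ⁅ v ⁆) UB)
... | inj₁ T⊆CL = ℕ.≤-trans (p⊆q⇒∣p∣≤∣q∣ T⊆CL) ∣CL∣≤UB
... | inj₂ (u , u∈T , u∉CL) = u∉ConflictOrLoose⇒∣T∣≤UB G T⊆I′ S∩T≡∅ plex u∈T u∉CL
  where
  S∩T≡∅ : ∀ {x} → x ∈ S → x ∉ T
  S∩T≡∅ x∈S x∈T = C∩S≡∅ _ (∪-⊆ I⊆C (x∈p⇒⁅x⁆⊆p v∈C) (T⊆I′ x∈T)) x∈S
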